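{- Let $F$ and $g$ be positive integers with $g \leq F \leq 2g-1$, let $x \in \mathcal{E}^K(F,g)$ and $z \in [x]$. Then $y$ is a child of $z$ in $\mathcal{G}^K([x])$ if and only if $y = z + e_i - e_{F-i}$, where $i \in \{1,\ldots,2g-1\}$ satisfies: (1) $z_i = 0$; (2) $z_j + z_{i-j} \geq 1$ for all $1 \leq j < i$; (3) $\frac{F}{2} < i < F$; (4) $F - i < \min\{k \in \{1,\ldots,2g-1\} : z_k = 0\}$; (5) $2F \neq 3i$; (6) $z_{2(F-i)} = 0$; (7) $z_j + z_{2(F-i)-j} \geq 1$ for all $1 \leq j < 2(F-i)$; (8) $F - i \in \mathrm{PF}^K(z + e_i)$.
   Context: A numerical semigroup is a subset $S \subseteq \mathbb{N}$ (with $\mathbb{N}$ the nonnegative integers) closed under addition, containing $0$, with $\mathbb{N}\setminus S$ finite. The genus $\mathrm{g}(S)$ is $\#(\mathbb{N}\setminus S)$; the Frobenius number $\mathrm{F}(S)$ is the largest integer not in $S$; the multiplicity $\mathrm{m}(S)$ is the least positive integer in $S$; $S$ is elementary if $\mathrm{F}(S) < 2\,\mathrm{m}(S)$. If $S$ has genus $g \geq 1$ then $2g \in S$; for $i = 1,\ldots,2g-1$ let $w_i$ be the least element of $S$ congruent to $i$ modulo $2g$, and define the Kunz-coordinates vector $\mathcal{K}(S) = (x_1,\ldots,x_{2g-1})$ by $x_i = \frac{w_i - i}{2g}$. Let $\mathcal{K}(F,g) = \{\mathcal{K}(S) : S \text{ numerical semigroup with Frobenius number } F \text{ and genus } g\}$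 and $\mathcal{E}^K(F,g) = \{\mathcal{K}(S) : S \text{ elementary with Frobenius number } F \text{ and genus } g\}$. Let $e_i$ be the $i$-th unit vector of $\mathbb{Z}^{2g-1}$. Define $\theta^K(x) = x + \sum_{i < F/2,\ x_i = 0} e_i - \sum_{i < F/2,\ x_i = 0} e_{F-i}$ for $x \in \mathcal{K}(F,g)$, and for $x \in \mathcal{E}^K(F,g)$ let $[x] = \{y \in \mathcal{K}(F,g) : \theta^K(y) = \theta^K(x)\}$. The directed graph $\mathcal{G}^K([x])$ has vertex set $[x]$, and $(y,z)$ is an edge iff, with $m = \min\{k \in \{1,\ldots,2g-1\} : y_k = 0\}$, one has $F > 2m$ and $z = y + e_m - e_{F-m}$; in that case $y$ is called a child of $z$. For $y \in \{0,1\}^{2g-1}$ let $T_y = \{0\} \cup \{k \in \{1,\ldots,2g-1\} : y_k = 0\} \cup \{k \in \mathbb{Z} : k \geq 2g\}$ and $\mathrm{PF}^K(y) = \{p \in \mathbb{Z}\setminus T_y : p + s \in T_y \text{ for all } s \in T_y\setminus\{0\}\}$. -}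

module Defs where

open import Level using (0ℓ)
open import Data.Bool using (Bool; true; false; if_then_else_)
open import Data.Nat as ℕ using (ℕ; zero; suc; _≤_; _<_; _∸_; _≡ᵇ_; _<?_)
open import Data.Integer as ℤ using (ℤ; +_; _-_; _≥_)
open import Data.Integer.Divisibility using (_∣_)
open import Data.List using (List; []; _∷_; foldr; filter; length; upTo; map)
open import Data.List.Membership.Propositional using (_∈_)
open import Data.List.Relation.Unary.Unique.Propositional using (Unique)
open import Data.Product using (Σ; ∃; ∃-syntax; _×_; _,_)
open import Data.Sum using (_⊎_)
open import Function.Bundles using (_⇔_)
open import Relation.Nullary using (¬_; Dec; yes; no)
open import Relation.Nullary.Decidable using (_×-dec_)
open import Relation.Binary.PropositionalEquality using (_≡_; _≢_)
open import Relation.Unary using (Pred)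

record NumericalSemigroup (S : Pred ℕ 0ℓ) : Set where
  field
    has-zero     : S 0
    closed-+     : ∀ a b → S a → S b → S (a ℕ.+ b)
    cofinite     : ∃[ N ] (∀ n → N ≤ n → S n)

Genus : Pred ℕ 0ℓ → ℕ → Set
Genus S g = ∃[ gaps ] (Unique gaps × (∀ n → (¬ S n) ⇔ (n ∈ gaps)) × length gaps ≡ g)

Frobenius : Pred ℕ 0ℓ → ℕ → Set
Frobenius S F = (¬ S F) × (∀ n → F < n → S n)

Multiplicity : Pred ℕ 0ℓ → ℕ → Set
Multiplicity S m = (0 < m) × S m × (∀ k → 0 < k → k < m → ¬ S k)

Elementary : Pred ℕ 0ℓ → ℕ → Set
Elementary S F = ∃[ m ] (Multiplicity S m × F < 2 ℕ.* m)

-- Vectors in ℤ^{2g-1}, 1-based: coordinate k for 1 ≤ k ≤ 2g-1 is v k;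
-- values at other indices are irrelevant (equality only compares 1..2g-1).

KVec : Set
KVec = ℕ → ℤ

InRange : ℕ → ℕ → Set
InRange g k = (1 ≤ k) × (k ≤ 2 ℕ.* g ∸ 1)

_≈[_]_ : KVec → ℕ → KVec → Set
u ≈[ g ] v = ∀ k → InRange g k → u k ≡ v k

_⊕_ : KVec → KVec → KVec
(u ⊕ v) k = u k ℤ.+ v k

_⊖_ : KVec → KVec → KVec
(u ⊖ v) k = u k - v k

infixl 6 _⊕_ _⊖_

e : ℕ → KVec
e i k = if k ≡ᵇ i then + 1 else + 0

LeastInClass : Pred ℕ 0ℓ → ℕ → ℕ → ℕ → Set
LeastInClass S n i w =
  S w × ((+ n) ∣ (+ w - + i)) × (∀ w′ → S w′ → (+ n) ∣ (+ w′ - + i) → w ≤ w′)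

IsKunz : ℕ → Pred ℕ 0ℓ → KVec → Set
IsKunz g S x = ∀ i → InRange g i →
  ∃[ w ] (LeastInClass S (2 ℕ.* g) i w × x i ℤ.* + (2 ℕ.* g) ≡ + w - + i)

InK : ℕ → ℕ → KVec → Set₁
InK F g x = ∃[ S ] (NumericalSemigroup S × Frobenius S F × Genus S g × IsKunz g S x)

InEK : ℕ → ℕ → KVec → Set₁
InEK F g x = ∃[ S ] (NumericalSemigroup S × Frobenius S F × Genus S g
                     × Elementary S F × IsKunz g S x)

indices : ℕ → List ℕ
indices g = map suc (upTo (2 ℕ.* g ∸ 1))

θK : ℕ → ℕ → KVec → KVec
θK F g x =
  foldr (λ i acc → acc ⊕ e i ⊖ e (F ∸ i)) x
        (filter (λ i → (2 ℕ.* i <? F) ×-dec (x i ℤ.≟ + 0)) (indices g))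

InClass : ℕ → ℕ → KVec → KVec → Set₁
InClass F g x y = InK F g y × (θK F g y ≈[ g ] θK F g x)

IsMinZero : ℕ → KVec → ℕ → Set
IsMinZero g y m = InRange g m × y m ≡ + 0 × (∀ k → 1 ≤ k → k < m → y k ≢ + 0)

EdgeK : ℕ → ℕ → KVec → KVec → Set
EdgeK F g y z =
  ∃[ m ] (IsMinZero g y m × 2 ℕ.* m < F × z ≈[ g ] (y ⊕ e m ⊖ e (F ∸ m)))

ChildK : ℕ → ℕ → KVec → KVec → KVec → Set₁
ChildK F g x y z = InClass F g x y × InClass F g x z × EdgeK F g y z

InT : ℕ → KVec → ℤ → Set
InT g y p = (p ≡ + 0)
          ⊎ (∃[ k ] (p ≡ + k × InRange g k × y k ≡ + 0))
          ⊎ (p ≥ + (2 ℕ.* g))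

InPFK : ℕ → KVec → ℤ → Set
InPFK g y p = (¬ InT g y p) × (∀ s → InT g y s → s ≢ + 0 → InT g y (p ℤ.+ s))

-- For F < 2g every x ∈ 𝒦(F,g) is a 0/1 vector whose zeros are exactly the
-- elements of S in 1, …, 2g-1, so x is nothing but the numerical semigroup
-- T_x it encodes.  An edge (y , z) with m the least zero of y trades the
-- element m of T_y for i = F - m, giving T_z.  Reading the edge backwards,
-- the conditions (1)–(8) say precisely that (T_z ∖ {i}) ∪ {m} is again a
-- numerical semigroup with Frobenius number F whose least element is m:
-- (2) and (4) handle sums avoiding m, (5) and (6) the sum m + m, (8) the
-- sums m + s, while (7) holds automatically because 1, …, m are gaps of
-- T_z.  θ^K does not see the trade: m is counted by θ^K(y) but not by
-- θ^K(z), i never (as 2i > F), and the correction e_m - e_{F-m} that m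
-- contributes is exactly z - y.

module Submission where

open import Defs
open import Level using (0ℓ)
open import Data.Bool using (true; false; T)
open import Data.Bool.Properties using (T-≡)
open import Data.Nat as ℕ using (ℕ; zero; suc; _≤_; _<_; _∸_; _*_; z≤n; s≤s; _≡ᵇ_; _<?_)
import Data.Nat.Properties as ℕP
import Data.Nat.Divisibility as ℕD
open import Data.Integer as ℤ using (ℤ; +_; _+_; _-_; _≥_)
import Data.Integer.Properties as ℤP
open import Data.Integer.Divisibility using () renaming (_∣_ to _∣ℤ_)
open import Data.Integer.Tactic.RingSolver using (solve-∀)
open import Data.List using (List; []; _∷_; filter; foldr; map)
import Data.List.Properties as ListP
open import Data.List.Membership.Propositional using (_∈_)
open import Data.List.Membership.Propositional.Properties using (∈-map⁺; ∈-map⁻; ∈-upTo⁺; ∈-upTo⁻)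
open import Data.List.Relation.Unary.All using (_∷_)
import Data.List.Relation.Unary.All as All
open import Data.List.Relation.Unary.AllPairs using (_∷_)
open import Data.List.Relation.Unary.Any using (here; there)
open import Data.List.Relation.Unary.Unique.Propositional using (Unique)
import Data.List.Relation.Unary.Unique.Propositional.Properties as UniqueP
open import Data.Product using (∃-syntax; _×_; _,_; proj₁; proj₂)
open import Data.Sum using (_⊎_; inj₁; inj₂)
open import Data.Empty using (⊥; ⊥-elim)
open import Function.Base using (_∘_)
open import Function.Bundles using (_⇔_; mk⇔; Equivalence)
open import Relation.Nullary using (¬_; Dec; yes; no)
open import Relation.Nullary.Decidable using (_×-dec_)
open import Relation.Binary.PropositionalEquality
open import Relation.Binary.Definitions using (tri<; tri≈; tri>)
open import Relation.Unary using (Pred; Decidable; _≐_)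

open Equivalence using (to; from)

2*m≡m+m : ∀ m → 2 * m ≡ m ℕ.+ m
2*m≡m+m m = cong (m ℕ.+_) (ℕP.+-identityʳ m)

m+i≡F∧2m<F⇒m<i : ∀ {m i F} → m ℕ.+ i ≡ F → 2 * m < F → m < i
m+i≡F∧2m<F⇒m<i {m} {i} refl 2m<F = ℕP.+-cancelˡ-< m m i (subst (_< m ℕ.+ i) (2*m≡m+m m) 2m<F)

m+i≡F∧F<2i⇒m<i : ∀ {m i F} → m ℕ.+ i ≡ F → F < 2 * i → m < i
m+i≡F∧F<2i⇒m<i {m} {i} refl F<2i = ℕP.+-cancelʳ-< i m i (subst (m ℕ.+ i <_) (2*m≡m+m i) F<2i)

m+i≡F∧m<i⇒2m<F : ∀ {m i F} → m ℕ.+ i ≡ F → m < i → 2 * m < F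
m+i≡F∧m<i⇒2m<F {m} {i} refl m<i = subst (_< m ℕ.+ i) (sym (2*m≡m+m m)) (ℕP.+-monoʳ-< m m<i)

m+i≡F∧m<i⇒F<2i : ∀ {m i F} → m ℕ.+ i ≡ F → m < i → F < 2 * i
m+i≡F∧m<i⇒F<2i {m} {i} refl m<i = subst (m ℕ.+ i <_) (sym (2*m≡m+m i)) (ℕP.+-monoˡ-< i m<i)

-- 3 * i unfolds to i + 2 * i.
m+i≡F⇒[2F≡3i⇔2m≡i] : ∀ {m i F} → m ℕ.+ i ≡ F → 2 * F ≡ 3 * i ⇔ 2 * m ≡ i
m+i≡F⇒[2F≡3i⇔2m≡i] {m} {i} refl = mk⇔
  (λ eq → ℕP.+-cancelʳ-≡ (2 * i) (2 * m) i (trans (sym (ℕP.*-distribˡ-+ 2 m i)) eq))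
  (λ eq → trans (ℕP.*-distribˡ-+ 2 m i) (cong (ℕ._+ 2 * i) eq))

InRange⇒< : ∀ {g k} → InRange g k → k < 2 * g
InRange⇒< {g} {suc k} (_ , k≤) with 2 * g
... | suc n = s≤s k≤

<⇒InRange : ∀ {g k} → 1 ≤ k → k < 2 * g → InRange g k
<⇒InRange {g} 1≤k k<2g with 2 * g
... | suc n = 1≤k , ℕP.≤-pred k<2g

InRange-≤ : ∀ {g j k} → 1 ≤ j → j ≤ k → InRange g k → InRange g j
InRange-≤ 1≤j j≤k (_ , k≤) = 1≤j , ℕP.≤-trans j≤k k≤

InRange-trichotomy : ∀ g n → n ≡ 0 ⊎ InRange g n ⊎ 2 * g ≤ n
InRange-trichotomy g zero = inj₁ refl
InRange-trichotomy g (suc n) with suc n <? 2 * g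
... | yes n<2g = inj₂ (inj₁ (<⇒InRange {g} (s≤s z≤n) n<2g))
... | no n≮2g = inj₂ (inj₂ (ℕP.≮⇒≥ n≮2g))

e-diag : ∀ i → e i i ≡ + 1
e-diag i rewrite to T-≡ (ℕP.≡⇒≡ᵇ i i refl) = refl

e-off : ∀ {i k} → k ≢ i → e i k ≡ + 0
e-off {i} {k} k≢i with k ≡ᵇ i in eq
... | true = ⊥-elim (k≢i (ℕP.≡ᵇ⇒≡ k i (subst T (sym eq) _)))
... | false = refl

module _ {a b : ℕ} (v : KVec) where

  ⊕e⊖e-at-added : a ≢ b → (v ⊕ e a ⊖ e b) a ≡ v a + + 1
  ⊕e⊖e-at-added a≢b rewrite e-diag a | e-off a≢b = ℤP.+-identityʳ (v a + + 1)

  ⊕e⊖e-at-removed : a ≢ b → (v ⊕ e a ⊖ e b) b ≡ v b - + 1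
  ⊕e⊖e-at-removed a≢b rewrite e-off (a≢b ∘ sym) | e-diag b = cong (_- + 1) (ℤP.+-identityʳ (v b))

  ⊕e⊖e-elsewhere : ∀ {k} → k ≢ a → k ≢ b → (v ⊕ e a ⊖ e b) k ≡ v k
  ⊕e⊖e-elsewhere {k} k≢a k≢b rewrite e-off k≢a | e-off k≢b =
    trans (ℤP.+-identityʳ (v k + + 0)) (ℤP.+-identityʳ (v k))

⊕e⊖e-inverse : ∀ {g a b} {u v : KVec} → u ≈[ g ] (v ⊕ e a ⊖ e b) → v ≈[ g ] (u ⊕ e b ⊖ e a)
⊕e⊖e-inverse {a = a} {b} {u} {v} u≈ k r =
  trans (cancel (v k) (e a k) (e b k)) (cong (λ t → t + e b k - e a k) (sym (u≈ k r)))
  where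
  cancel : ∀ x p q → x ≡ x + p - q + q - p
  cancel = solve-∀

IsBit : ℤ → Set
IsBit x = x ≡ + 0 ⊎ x ≡ + 1

Bits : ℕ → KVec → Set
Bits g v = ∀ {k} → InRange g k → IsBit (v k)

0≢1 : + 0 ≢ + 1
0≢1 ()

2-not-bit : ¬ IsBit (+ 2)
2-not-bit (inj₁ ())
2-not-bit (inj₂ ())

0-not-≥1 : ¬ (+ 0 ≥ + 1)
0-not-≥1 (ℤ.+≤+ ())

bit-sum≥1 : ∀ {a b} → IsBit a → IsBit b → (a ≡ + 0 → b ≡ + 0 → ⊥) → a + b ≥ + 1
bit-sum≥1 (inj₁ refl) (inj₁ refl) not-both = ⊥-elim (not-both refl refl)
bit-sum≥1 (inj₁ refl) (inj₂ refl) _ = ℤ.+≤+ (s≤s z≤n)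
bit-sum≥1 (inj₂ refl) (inj₁ refl) _ = ℤ.+≤+ (s≤s z≤n)
bit-sum≥1 (inj₂ refl) (inj₂ refl) _ = ℤ.+≤+ (s≤s z≤n)

InTℕ : ℕ → KVec → Pred ℕ 0ℓ
InTℕ g v n = InRange g n → v n ≡ + 0

ZeroClosed : ℕ → KVec → Set
ZeroClosed g v = ∀ {a b} → InRange g a → InRange g b → InRange g (a ℕ.+ b) →
  v a ≡ + 0 → v b ≡ + 0 → v (a ℕ.+ b) ≡ + 0

InTℕ-numericalSemigroup : ∀ {g v} → ZeroClosed g v → NumericalSemigroup (InTℕ g v)
InTℕ-numericalSemigroup {g} {v} closed = record
  { has-zero = λ { (() , _) }
  ; closed-+ = closed-+
  ; cofinite = 2 * g , λ n 2g≤n r → ⊥-elim (ℕP.<-irrefl refl (ℕP.<-≤-trans (InRange⇒< {g} r) 2g≤n))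
  }
  where
  closed-+ : ∀ a b → InTℕ g v a → InTℕ g v b → InTℕ g v (a ℕ.+ b)
  closed-+ zero b _ tb = tb
  closed-+ (suc a) zero ta _ rewrite ℕP.+-identityʳ a = ta
  closed-+ a@(suc _) b@(suc _) ta tb r =
    closed ra rb r (ta ra) (tb rb)
    where
    ra = InRange-≤ {g} (s≤s z≤n) (ℕP.m≤m+n a b) r
    rb = InRange-≤ {g} (s≤s z≤n) (ℕP.m≤n+m b a) r

InT⇔InTℕ : ∀ {g v n} → InT g v (+ n) ⇔ InTℕ g v n
InT⇔InTℕ {g} {v} {n} = mk⇔ ⇒ ⇐
  where
  ⇒ : InT g v (+ n) → InTℕ g v n
  ⇒ (inj₁ refl) (() , _)
  ⇒ (inj₂ (inj₁ (k , refl , _ , vk≡0))) _ = vk≡0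
  ⇒ (inj₂ (inj₂ (ℤ.+≤+ 2g≤n))) r = ⊥-elim (ℕP.<-irrefl refl (ℕP.<-≤-trans (InRange⇒< {g} r) 2g≤n))
  ⇐ : InTℕ g v n → InT g v (+ n)
  ⇐ t with InRange-trichotomy g n
  ... | inj₁ refl = inj₁ refl
  ... | inj₂ (inj₁ r) = inj₂ (inj₁ (n , refl , r , t r))
  ... | inj₂ (inj₂ 2g≤n) = inj₂ (inj₂ (ℤ.+≤+ 2g≤n))

InT⇒nonNegative : ∀ {g v s} → InT g v s → ∃[ n ] s ≡ + n
InT⇒nonNegative (inj₁ refl) = 0 , refl
InT⇒nonNegative (inj₂ (inj₁ (k , refl , _))) = k , refl
InT⇒nonNegative (inj₂ (inj₂ (ℤ.+≤+ {n = n} _))) = n , refl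

InPFℕ : ℕ → KVec → ℕ → Set
InPFℕ g v p = ¬ InTℕ g v p × (∀ k → 1 ≤ k → InTℕ g v k → InTℕ g v (p ℕ.+ k))

InPFK⇔InPFℕ : ∀ {g v p} → InPFK g v (+ p) ⇔ InPFℕ g v p
InPFK⇔InPFℕ {g} {v} {p} = mk⇔ ⇒ ⇐
  where
  ⇒ : InPFK g v (+ p) → InPFℕ g v p
  ⇒ (p∉T , p+T⊆T) = p∉T ∘ from (InT⇔InTℕ {g} {v}) , λ k 1≤k t →
    to (InT⇔InTℕ {g} {v}) (subst (InT g v) (sym (ℤP.pos-+ p k))
      (p+T⊆T (+ k) (from (InT⇔InTℕ {g} {v}) t) (λ { refl → ℕP.<-irrefl refl 1≤k })))
  ⇐ : InPFℕ g v p → InPFK g v (+ p)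
  ⇐ (p∉T , p+T⊆T) = p∉T ∘ to (InT⇔InTℕ {g} {v}) , λ s t s≢0 → p+s∈T s t s≢0 (InT⇒nonNegative {g} {v} t)
    where
    p+s∈T : ∀ s → InT g v s → s ≢ + 0 → ∃[ n ] s ≡ + n → InT g v (+ p + s)
    p+s∈T .(+ n) t s≢0 (n , refl) =
      subst (InT g v) (ℤP.pos-+ p n)
        (from (InT⇔InTℕ {g} {v}) (p+T⊆T n (ℕP.n≢0⇒n>0 (s≢0 ∘ cong (+_))) (to (InT⇔InTℕ {g} {v}) t)))

NumericalSemigroup-resp : ∀ {S T : Pred ℕ 0ℓ} → S ≐ T → NumericalSemigroup S → NumericalSemigroup T
NumericalSemigroup-resp (S⊆T , T⊆S) ns = record
  { has-zero = S⊆T has-zero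
  ; closed-+ = λ a b ta tb → S⊆T (closed-+ a b (T⊆S ta) (T⊆S tb))
  ; cofinite = proj₁ cofinite , λ n N≤n → S⊆T (proj₂ cofinite n N≤n)
  }
  where open NumericalSemigroup ns

Frobenius-resp : ∀ {S T : Pred ℕ 0ℓ} {F} → S ≐ T → Frobenius S F → Frobenius T F
Frobenius-resp (S⊆T , T⊆S) (F∉S , above) = F∉S ∘ T⊆S , λ n F<n → S⊆T (above n F<n)

Genus-resp : ∀ {S T : Pred ℕ 0ℓ} {g} → S ≐ T → Genus S g → Genus T g
Genus-resp (S⊆T , T⊆S) (gaps , unique , gap⇔ , length≡g) =
  gaps , unique , (λ n → mk⇔ (to (gap⇔ n) ∘ (_∘ S⊆T)) ((_∘ T⊆S) ∘ from (gap⇔ n))) , length≡g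

module _ (m i : ℕ) where

  transpose : ℕ → ℕ
  transpose k with k ℕP.≟ m | k ℕP.≟ i
  ... | yes _ | _ = i
  ... | no _ | yes _ = m
  ... | no _ | no _ = k

  transpose-m : transpose m ≡ i
  transpose-m with m ℕP.≟ m
  ... | yes _ = refl
  ... | no m≢m = ⊥-elim (m≢m refl)

  transpose-i : transpose i ≡ m
  transpose-i with i ℕP.≟ m | i ℕP.≟ i
  ... | yes i≡m | _ = i≡m
  ... | no _ | yes _ = refl
  ... | no _ | no i≢i = ⊥-elim (i≢i refl)

  transpose-other : ∀ {k} → k ≢ m → k ≢ i → transpose k ≡ k
  transpose-other {k} k≢m k≢i with k ℕP.≟ m | k ℕP.≟ i
  ... | yes k≡m | _ = ⊥-elim (k≢m k≡m)
  ... | no _ | yes k≡i = ⊥-elim (k≢i k≡i)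
  ... | no _ | no _ = refl

  transpose-involutive : ∀ k → transpose (transpose k) ≡ k
  transpose-involutive k with k ℕP.≟ m | k ℕP.≟ i
  ... | yes refl | _ = transpose-i
  ... | no _ | yes refl = transpose-m
  ... | no k≢m | no k≢i = transpose-other k≢m k≢i

  ∈-map-transpose⇔ : ∀ {n xs} → n ∈ map transpose xs ⇔ transpose n ∈ xs
  ∈-map-transpose⇔ {n} {xs} = mk⇔ ⇒ ⇐
    where
    ⇒ : n ∈ map transpose xs → transpose n ∈ xs
    ⇒ n∈ with ∈-map⁻ transpose n∈
    ... | k , k∈ , refl = subst (_∈ xs) (sym (transpose-involutive k)) k∈
    ⇐ : transpose n ∈ xs → n ∈ map transpose xs
    ⇐ tn∈ = subst (_∈ map transpose xs) (transpose-involutive n) (∈-map⁺ transpose tn∈)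

  genus-exchange : ∀ {S T : Pred ℕ 0ℓ} {g} → Genus S g →
    ¬ S m → S i → T m → ¬ T i →
    (∀ {n} → n ≢ m → n ≢ i → S n → T n) → (∀ {n} → n ≢ m → n ≢ i → T n → S n) →
    Genus T g
  genus-exchange {S} {T} (gaps , unique , gap⇔ , length≡g) m∉S i∈S m∈T i∉T S⊆T T⊆S =
    map transpose gaps ,
    UniqueP.map⁺ (λ {a} {b} eq → trans (sym (transpose-involutive a))
                                   (trans (cong transpose eq) (transpose-involutive b))) unique ,
    (λ n → mk⇔ (from ∈-map-transpose⇔ ∘ to (gap⇔ (transpose n)) ∘ gap-transpose⇒ n)
               (gap-transpose⇐ n ∘ from (gap⇔ (transpose n)) ∘ to ∈-map-transpose⇔)) ,
    trans (ListP.length-map transpose gaps) length≡g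
    where
    gap-transpose⇒ : ∀ n → ¬ T n → ¬ S (transpose n)
    gap-transpose⇒ n n∉T = cases (n ℕP.≟ m) (n ℕP.≟ i)
      where
      cases : Dec (n ≡ m) → Dec (n ≡ i) → ¬ S (transpose n)
      cases (yes refl) _ = ⊥-elim (n∉T m∈T)
      cases (no _) (yes refl) = subst (¬_ ∘ S) (sym transpose-i) m∉S
      cases (no n≢m) (no n≢i) = subst (¬_ ∘ S) (sym (transpose-other n≢m n≢i)) (n∉T ∘ S⊆T n≢m n≢i)
    gap-transpose⇐ : ∀ n → ¬ S (transpose n) → ¬ T n
    gap-transpose⇐ n tn∉S = cases (n ℕP.≟ m) (n ℕP.≟ i)
      where
      cases : Dec (n ≡ m) → Dec (n ≡ i) → ¬ T n
      cases (yes refl) _ = ⊥-elim (tn∉S (subst S (sym transpose-m) i∈S))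
      cases (no _) (yes refl) = i∉T
      cases (no n≢m) (no n≢i) = subst (¬_ ∘ S) (transpose-other n≢m n≢i) tn∉S ∘ T⊆S n≢m n≢i

+[k+n]-+k≡+n : ∀ k n → + (k ℕ.+ n) - + k ≡ + n
+[k+n]-+k≡+n k n = trans (cong (_- + k) (ℤP.pos-+ k n)) (cancel (+ k) (+ n))
  where
  cancel : ∀ a b → a + b - a ≡ b
  cancel = solve-∀

+n∣+[k+n]-+k : ∀ k n → + n ∣ℤ + (k ℕ.+ n) - + k
+n∣+[k+n]-+k k n = subst (n ℕD.∣_) (sym (cong ℤ.∣_∣ (+[k+n]-+k≡+n k n))) ℕD.∣-refl

+n∣+k-+k : ∀ k n → + n ∣ℤ + k - + k
+n∣+k-+k k n = subst (n ℕD.∣_) (sym (cong ℤ.∣_∣ (ℤP.+-inverseʳ (+ k)))) (n ℕD.∣0)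

congruent⇒≡∨+≤ : ∀ {n k w} → k < n → + n ∣ℤ + w - + k → w ≡ k ⊎ k ℕ.+ n ≤ w
congruent⇒≡∨+≤ {n} {k} {w} k<n n∣w-k with w <? k
... | yes w<k = ⊥-elim (ℕP.<-irrefl refl (ℕP.<-≤-trans k<n (begin
      n      ≤⟨ ℕD.∣⇒≤ {{ℕ.>-nonZero (ℕP.m<n⇒0<n∸m w<k)}} n∣k∸w ⟩
      k ∸ w  ≤⟨ ℕP.m∸n≤m k w ⟩
      k      ∎)))
  where
  open ℕP.≤-Reasoning
  n∣k∸w : n ℕD.∣ k ∸ w
  n∣k∸w = subst (n ℕD.∣_) (trans (cong ℤ.∣_∣ (ℤP.m-n≡m⊖n w k)) (ℤP.∣⊖∣-< w<k)) n∣w-k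
... | no w≮k = cases (subst (n ℕD.∣_) ∣w-k∣≡w∸k n∣w-k)
  where
  k≤w = ℕP.≮⇒≥ w≮k
  ∣w-k∣≡w∸k : ℤ.∣ + w - + k ∣ ≡ w ∸ k
  ∣w-k∣≡w∸k = trans (cong ℤ.∣_∣ (ℤP.m-n≡m⊖n w k))
                (trans (ℤP.∣m⊖n∣≡∣n⊖m∣ w k) (ℤP.∣⊖∣-≤ k≤w))
  cases : n ℕD.∣ w ∸ k → w ≡ k ⊎ k ℕ.+ n ≤ w
  cases (ℕD.divides zero w∸k≡0) = inj₁ (ℕP.≤-antisym (ℕP.m∸n≡0⇒m≤n w∸k≡0) k≤w)
  cases (ℕD.divides (suc q) w∸k≡) = inj₂ (begin
      k ℕ.+ n            ≤⟨ ℕP.+-monoʳ-≤ k (ℕP.m≤m+n n (q * n)) ⟩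
      k ℕ.+ suc q * n    ≡⟨ cong (k ℕ.+_) (sym w∸k≡) ⟩
      k ℕ.+ (w ∸ k)      ≡⟨ ℕP.m+[n∸m]≡n k≤w ⟩
      w                  ∎)
    where open ℕP.≤-Reasoning

module _ {F g : ℕ} (F<2g : F < 2 * g) where

  instance
    2g-nonZero : ℕ.NonZero (2 * g)
    2g-nonZero = ℕ.>-nonZero (ℕP.≤-<-trans z≤n F<2g)

  kunz-bit : ∀ {S v k} → Frobenius S F → IsKunz g S v → InRange g k →
    (v k ≡ + 0 × S k) ⊎ (v k ≡ + 1 × ¬ S k)
  -- k + 2g > F lies in S, so the least element of S congruent to k is k or k + 2g.
  kunz-bit {S} {v} {k} (_ , above-F) kunz r
    with kunz k r
  ... | w , (w∈S , 2g∣w-k , least) , vk*2g≡w-k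
    with congruent⇒≡∨+≤ (InRange⇒< {g} r) 2g∣w-k
  ... | inj₁ refl =
    inj₁ (ℤP.*-cancelʳ-≡ (v k) (+ 0) (+ (2 * g)) (trans vk*2g≡w-k (ℤP.+-inverseʳ (+ k))) , w∈S)
  ... | inj₂ k+2g≤w = inj₂ (vk≡1 , k∉S)
    where
    w≡k+2g : w ≡ k ℕ.+ 2 * g
    w≡k+2g = ℕP.≤-antisym
      (least _ (above-F _ (ℕP.<-≤-trans F<2g (ℕP.m≤n+m (2 * g) k))) (+n∣+[k+n]-+k k (2 * g)))
      k+2g≤w
    vk≡1 : v k ≡ + 1
    vk≡1 = ℤP.*-cancelʳ-≡ (v k) (+ 1) (+ (2 * g))
      (trans vk*2g≡w-k (trans (cong (λ t → + t - + k) w≡k+2g)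
        (trans (+[k+n]-+k≡+n k (2 * g)) (sym (ℤP.*-identityˡ (+ (2 * g)))))))
    k∉S : ¬ S k
    k∉S k∈S = ℕP.<-irrefl refl (ℕP.<-≤-trans (ℕP.m<m+n k (ℕ.>-nonZero⁻¹ (2 * g)))
                (ℕP.≤-trans k+2g≤w (least k k∈S (+n∣+k-+k k (2 * g)))))

  kunz-semigroup≐InTℕ : ∀ {S v} → NumericalSemigroup S → Frobenius S F → IsKunz g S v → S ≐ InTℕ g v
  kunz-semigroup≐InTℕ {S} {v} ns frobenius kunz = S⊆T , T⊆S
    where
    S⊆T : ∀ {n} → S n → InTℕ g v n
    S⊆T n∈S r with kunz-bit {S} {v} frobenius kunz r
    ... | inj₁ (vn≡0 , _) = vn≡0
    ... | inj₂ (_ , n∉S) = ⊥-elim (n∉S n∈S)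
    T⊆S : ∀ {n} → InTℕ g v n → S n
    T⊆S {n} t with InRange-trichotomy g n
    ... | inj₁ refl = NumericalSemigroup.has-zero ns
    ... | inj₂ (inj₂ 2g≤n) = proj₂ frobenius n (ℕP.<-≤-trans F<2g 2g≤n)
    ... | inj₂ (inj₁ r) with kunz-bit {S} {v} frobenius kunz r
    ...   | inj₁ (_ , n∈S) = n∈S
    ...   | inj₂ (vn≡1 , _) = ⊥-elim (0≢1 (trans (sym (t r)) vn≡1))

  kunz-bits : ∀ {S v} → Frobenius S F → IsKunz g S v → Bits g v
  kunz-bits {S} {v} frobenius kunz r with kunz-bit {S} {v} frobenius kunz r
  ... | inj₁ (vk≡0 , _) = inj₁ vk≡0
  ... | inj₂ (vk≡1 , _) = inj₂ vk≡1

InTℕ-isKunz : ∀ {g v} → Bits g v → IsKunz g (InTℕ g v) v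
InTℕ-isKunz {g} {v} bits k r with bits r
... | inj₁ vk≡0 = k , ((λ _ → vk≡0) , +n∣+k-+k k (2 * g) , least) , vk*2g≡0
  where
  least : ∀ w → InTℕ g v w → + (2 * g) ∣ℤ + w - + k → k ≤ w
  least w _ 2g∣w-k with congruent⇒≡∨+≤ (InRange⇒< {g} r) 2g∣w-k
  ... | inj₁ refl = ℕP.≤-refl
  ... | inj₂ k+2g≤w = ℕP.≤-trans (ℕP.m≤m+n k (2 * g)) k+2g≤w
  vk*2g≡0 : v k ℤ.* + (2 * g) ≡ + k - + k
  vk*2g≡0 rewrite vk≡0 = sym (ℤP.+-inverseʳ (+ k))
... | inj₂ vk≡1 = k ℕ.+ 2 * g , (k+2g∈T , +n∣+[k+n]-+k k (2 * g) , least) , vk*2g≡2g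
  where
  k+2g∈T : InTℕ g v (k ℕ.+ 2 * g)
  k+2g∈T r′ = ⊥-elim (ℕP.<-irrefl refl (ℕP.<-≤-trans (InRange⇒< {g} r′) (ℕP.m≤n+m (2 * g) k)))
  least : ∀ w → InTℕ g v w → + (2 * g) ∣ℤ + w - + k → k ℕ.+ 2 * g ≤ w
  least w w∈T 2g∣w-k with congruent⇒≡∨+≤ (InRange⇒< {g} r) 2g∣w-k
  ... | inj₁ refl = ⊥-elim (0≢1 (trans (sym (w∈T r)) vk≡1))
  ... | inj₂ k+2g≤w = k+2g≤w
  vk*2g≡2g : v k ℤ.* + (2 * g) ≡ + (k ℕ.+ 2 * g) - + k
  vk*2g≡2g rewrite vk≡1 = trans (ℤP.*-identityˡ (+ (2 * g))) (sym (+[k+n]-+k≡+n k (2 * g)))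

-- For F < 2g a vector of 𝒦(F,g) is the same as a 0/1 vector v for which T_v
-- is a numerical semigroup with Frobenius number F and genus g.
record IsBitKunz (F g : ℕ) (v : KVec) : Set where
  field
    bits      : Bits g v
    semigroup : NumericalSemigroup (InTℕ g v)
    frobenius : Frobenius (InTℕ g v) F
    genus     : Genus (InTℕ g v) g

InK⇒IsBitKunz : ∀ {F g v} → F < 2 * g → InK F g v → IsBitKunz F g v
InK⇒IsBitKunz {g = g} {v} F<2g (S , ns , frobenius , genus , kunz) = record
  { bits      = kunz-bits {g = g} F<2g {S} {v} frobenius kunz
  ; semigroup = NumericalSemigroup-resp S≐T ns
  ; frobenius = Frobenius-resp S≐T frobenius
  ; genus     = Genus-resp S≐T genus
  }
  where S≐T = kunz-semigroup≐InTℕ {g = g} F<2g {S} {v} ns frobenius kunz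

IsBitKunz⇒InK : ∀ {F g v} → IsBitKunz F g v → InK F g v
IsBitKunz⇒InK {g = g} {v} K = InTℕ g v , semigroup , frobenius , genus , InTℕ-isKunz {g} {v} bits
  where open IsBitKunz K

first-zero : ∀ (v : KVec) p → (∀ k → 1 ≤ k → k ≤ p → v k ≢ + 0)
  ⊎ ∃[ m ] (1 ≤ m × m ≤ p × v m ≡ + 0 × (∀ k → 1 ≤ k → k < m → v k ≢ + 0))
first-zero v zero = inj₁ λ { (suc _) _ () }
first-zero v (suc p) with first-zero v p
... | inj₂ (m , 1≤m , m≤p , vm≡0 , below) = inj₂ (m , 1≤m , ℕP.m≤n⇒m≤1+n m≤p , vm≡0 , below)
... | inj₁ none with v (suc p) ℤ.≟ + 0
...   | yes vp≡0 = inj₂ (suc p , s≤s z≤n , ℕP.≤-refl , vp≡0 , λ k 1≤k k≤p → none k 1≤k (ℕP.≤-pred k≤p))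
...   | no vp≢0 = inj₁ λ k 1≤k k≤1+p → case k 1≤k (ℕP.m≤n⇒m<n∨m≡n k≤1+p)
  where
  case : ∀ k → 1 ≤ k → k < suc p ⊎ k ≡ suc p → v k ≢ + 0
  case k 1≤k (inj₁ k<1+p) = none k 1≤k (ℕP.≤-pred k<1+p)
  case k 1≤k (inj₂ refl) = vp≢0

IsMinZero-exists : ∀ {g} {v : KVec} {p} → InRange g p → v p ≡ + 0 → ∃[ m ] IsMinZero g v m
IsMinZero-exists {g} {v} {p} (1≤p , p≤) vp≡0 with first-zero v p
... | inj₁ none = ⊥-elim (none p 1≤p ℕP.≤-refl vp≡0)
... | inj₂ (m , 1≤m , m≤p , vm≡0 , below) = m , (1≤m , ℕP.≤-trans m≤p p≤) , vm≡0 , below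

θ-summand? : (F : ℕ) (v : KVec) → Decidable (λ j → 2 * j < F × v j ≡ + 0)
θ-summand? F v j = (2 * j <? F) ×-dec (v j ℤ.≟ + 0)

correction : ℕ → List ℕ → KVec
correction F = foldr (λ j acc → acc ⊕ e j ⊖ e (F ∸ j)) (λ _ → + 0)

foldr≡+correction : ∀ F (v : KVec) L k →
  foldr (λ j acc → acc ⊕ e j ⊖ e (F ∸ j)) v L k ≡ v k + correction F L k
foldr≡+correction F v [] k = sym (ℤP.+-identityʳ (v k))
foldr≡+correction F v (j ∷ L) k rewrite foldr≡+correction F v L k =
  reassoc (v k) (correction F L k) (e j k) (e (F ∸ j) k)
  where
  reassoc : ∀ a s p q → a + s + p - q ≡ a + (s + p - q)
  reassoc = solve-∀

module _ {P Q : Pred ℕ 0ℓ} (P? : Decidable P) (Q? : Decidable Q) where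

  filter-agree : ∀ {L} → (∀ {j} → j ∈ L → P j ⇔ Q j) → filter P? L ≡ filter Q? L
  filter-agree {[]} _ = refl
  filter-agree {j ∷ L} P⇔Q with Q? j
  ... | yes qj = trans (ListP.filter-accept P? (from (P⇔Q (here refl)) qj))
                       (cong (j ∷_) (filter-agree (P⇔Q ∘ there)))
  ... | no ¬qj = trans (ListP.filter-reject P? (¬qj ∘ to (P⇔Q (here refl))))
                       (filter-agree (P⇔Q ∘ there))

  correction-filter-flip : ∀ {m L} → Unique L → m ∈ L → P m → ¬ Q m →
    (∀ {j} → j ∈ L → j ≢ m → P j ⇔ Q j) →
    ∀ F k → correction F (filter P? L) k ≡ correction F (filter Q? L) k + e m k - e (F ∸ m) k
  correction-filter-flip {m} {.m ∷ L} (m∉L ∷ _) (here refl) pm ¬qm P⇔Q F k = begin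
    correction F (filter P? (m ∷ L)) k  ≡⟨ cong (λ l → correction F l k) (ListP.filter-accept P? pm) ⟩
    correction F (m ∷ filter P? L) k    ≡⟨ cong (λ l → correction F (m ∷ l) k) (filter-agree P⇔Q′) ⟩
    correction F (m ∷ filter Q? L) k    ≡⟨ cong (λ l → correction F l k + e m k - e (F ∸ m) k)
                                            (ListP.filter-reject Q? ¬qm) ⟨
    correction F (filter Q? (m ∷ L)) k + e m k - e (F ∸ m) k ∎
    where
    open ≡-Reasoning
    P⇔Q′ : ∀ {j} → j ∈ L → P j ⇔ Q j
    P⇔Q′ j∈L = P⇔Q (there j∈L) (All.lookup m∉L j∈L ∘ sym)
  correction-filter-flip {m} {j ∷ L} (j∉L ∷ unique) (there m∈L) pm ¬qm P⇔Q F k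
    with ih ← correction-filter-flip unique m∈L pm ¬qm (P⇔Q ∘ there) F k
       | j≢m ← All.lookup j∉L m∈L
       | Q? j
  ... | yes qj = begin
    correction F (filter P? (j ∷ L)) k
      ≡⟨ cong (λ l → correction F l k) (ListP.filter-accept P? (from (P⇔Q (here refl) j≢m) qj)) ⟩
    correction F (filter P? L) k + e j k - e (F ∸ j) k
      ≡⟨ cong (λ s → s + e j k - e (F ∸ j) k) ih ⟩
    correction F (filter Q? L) k + e m k - e (F ∸ m) k + e j k - e (F ∸ j) k
      ≡⟨ swap (correction F (filter Q? L) k) (e m k) (e (F ∸ m) k) (e j k) (e (F ∸ j) k) ⟩
    correction F (filter Q? L) k + e j k - e (F ∸ j) k + e m k - e (F ∸ m) k
      ∎
    where
    open ≡-Reasoning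
    swap : ∀ s a b c d → s + a - b + c - d ≡ s + c - d + a - b
    swap = solve-∀
  ... | no ¬qj =
    trans (cong (λ l → correction F l k) (ListP.filter-reject P? (¬qj ∘ to (P⇔Q (here refl) j≢m)))) ih

indices-unique : ∀ g → Unique (indices g)
indices-unique g = UniqueP.map⁺ ℕP.suc-injective (UniqueP.upTo⁺ _)

∈-indices⇒InRange : ∀ {g j} → j ∈ indices g → InRange g j
∈-indices⇒InRange j∈ with ∈-map⁻ suc j∈
... | t , t∈ , refl = s≤s z≤n , ∈-upTo⁻ t∈

InRange⇒∈-indices : ∀ {g j} → InRange g j → j ∈ indices g
InRange⇒∈-indices {j = suc t} (_ , t<) = ∈-map⁺ suc (∈-upTo⁺ t<)

θK-flip : ∀ {F g m} {u v : KVec} → InRange g m → 2 * m < F → u m ≡ + 0 → v m ≢ + 0 →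
  (∀ {j} → InRange g j → j ≢ m → 2 * j < F → u j ≡ v j) →
  u ≈[ g ] (v ⊕ e (F ∸ m) ⊖ e m) → θK F g u ≈[ g ] θK F g v
θK-flip {F} {g} {m} {u} {v} mr 2m<F um≡0 vm≢0 u≡v u≈ k r = begin
  θK F g u k
    ≡⟨ foldr≡+correction F u (fu (indices g)) k ⟩
  u k + correction F (fu (indices g)) k
    ≡⟨ cong₂ _+_ (u≈ k r) correction≡ ⟩
  (v k + e (F ∸ m) k - e m k) + (correction F (fv (indices g)) k + e m k - e (F ∸ m) k)
    ≡⟨ cancel (v k) _ (e m k) (e (F ∸ m) k) ⟩
  v k + correction F (fv (indices g)) k
    ≡⟨ foldr≡+correction F v (fv (indices g)) k ⟨
  θK F g v k
    ∎
  where
  open ≡-Reasoning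
  fu = filter (θ-summand? F u)
  fv = filter (θ-summand? F v)
  cancel : ∀ x s a b → (x + b - a) + (s + a - b) ≡ x + s
  cancel = solve-∀
  agree : ∀ {j} → j ∈ indices g → j ≢ m → (2 * j < F × u j ≡ + 0) ⇔ (2 * j < F × v j ≡ + 0)
  agree j∈ j≢m = mk⇔
    (λ (2j<F , uj≡0) → 2j<F , trans (sym (u≡v (∈-indices⇒InRange {g} j∈) j≢m 2j<F)) uj≡0)
    (λ (2j<F , vj≡0) → 2j<F , trans (u≡v (∈-indices⇒InRange {g} j∈) j≢m 2j<F) vj≡0)
  correction≡ = correction-filter-flip (θ-summand? F u) (θ-summand? F v) (indices-unique g)
             (InRange⇒∈-indices {g} mr) (2m<F , um≡0) (vm≢0 ∘ proj₂) agree F k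

ChildCriterion : ℕ → ℕ → KVec → KVec → ℕ → Set
ChildCriterion F g z y i =
  InRange g i × (y ≈[ g ] (z ⊕ e i ⊖ e (F ∸ i)))
  × (z i ≡ + 0)
  × (∀ j → 1 ≤ j → j < i → z j + z (i ∸ j) ≥ + 1)
  × (F < 2 * i × i < F)
  × (∃[ m ] (IsMinZero g z m × F ∸ i < m))
  × (2 * F ≢ 3 * i)
  × (z (2 * (F ∸ i)) ≡ + 0)
  × (∀ j → 1 ≤ j → j < 2 * (F ∸ i) → z j + z (2 * (F ∸ i) ∸ j) ≥ + 1)
  × InPFK g (z ⊕ e i) (+ (F ∸ i))

module Exchange {F g m i : ℕ} (F<2g : F < 2 * g) (m+i≡F : m ℕ.+ i ≡ F) (1≤m : 1 ≤ m) (m<i : m < i)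
            {y z : KVec} (y≈ : y ≈[ g ] (z ⊕ e i ⊖ e m)) (zm≡1 : z m ≡ + 1) (zi≡0 : z i ≡ + 0) where

  m≢i : m ≢ i
  m≢i = ℕP.<⇒≢ m<i

  i<F : i < F
  i<F = subst (i <_) m+i≡F (ℕP.m<n+m i 1≤m)

  2m<F : 2 * m < F
  2m<F = m+i≡F∧m<i⇒2m<F m+i≡F m<i

  F<2i : F < 2 * i
  F<2i = m+i≡F∧m<i⇒F<2i m+i≡F m<i

  F∸m≡i : F ∸ m ≡ i
  F∸m≡i = trans (cong (_∸ m) (sym m+i≡F)) (ℕP.m+n∸m≡n m i)

  F∸i≡m : F ∸ i ≡ m
  F∸i≡m = trans (cong (_∸ i) (sym m+i≡F)) (ℕP.m+n∸n≡m m i)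

  m<2m : m < 2 * m
  m<2m = ℕP.m<m+n m (ℕP.≤-trans 1≤m (ℕP.m≤m+n m 0))

  ir : InRange g i
  ir = <⇒InRange {g} (ℕP.≤-trans 1≤m (ℕP.<⇒≤ m<i)) (ℕP.<-trans i<F F<2g)

  mr : InRange g m
  mr = InRange-≤ {g} 1≤m (ℕP.<⇒≤ m<i) ir

  2mr : InRange g (2 * m)
  2mr = <⇒InRange {g} (ℕP.≤-trans 1≤m (ℕP.<⇒≤ m<2m)) (ℕP.<-trans 2m<F F<2g)

  ym≡0 : y m ≡ + 0
  ym≡0 = trans (y≈ m mr) (trans (⊕e⊖e-at-removed z (m≢i ∘ sym)) (cong (_- + 1) zm≡1))

  yi≡1 : y i ≡ + 1
  yi≡1 = trans (y≈ i ir) (trans (⊕e⊖e-at-added z (m≢i ∘ sym)) (cong (_+ + 1) zi≡0))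

  y≡z : ∀ {k} → InRange g k → k ≢ m → k ≢ i → y k ≡ z k
  y≡z r k≢m k≢i = trans (y≈ _ r) (⊕e⊖e-elsewhere z k≢i k≢m)

  y-zero⇒≢i : ∀ {k} → y k ≡ + 0 → k ≢ i
  y-zero⇒≢i yk≡0 refl = 0≢1 (trans (sym yk≡0) yi≡1)

  z-zero⇒≢m : ∀ {k} → z k ≡ + 0 → k ≢ m
  z-zero⇒≢m zk≡0 refl = 0≢1 (trans (sym zk≡0) zm≡1)

  z≈ : z ≈[ g ] (y ⊕ e m ⊖ e i)
  z≈ = ⊕e⊖e-inverse {g} y≈

  z⊕eᵢ≡y : ∀ {k} → InRange g k → k ≢ m → (z ⊕ e i) k ≡ y k
  z⊕eᵢ≡y {k} r k≢m with k ℕP.≟ i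
  ... | yes refl = trans (cong₂ _+_ zi≡0 (e-diag i)) (sym yi≡1)
  ... | no k≢i =
    trans (cong (λ t → z k + t) (e-off k≢i)) (trans (ℤP.+-identityʳ (z k)) (sym (y≡z r k≢m k≢i)))

  m∉T[z⊕eᵢ] : ¬ InTℕ g (z ⊕ e i) m
  m∉T[z⊕eᵢ] t = 0≢1 (trans (sym (t mr)) (cong₂ _+_ zm≡1 (e-off m≢i)))

  -- Off m the vectors z + e_i and y coincide, so the pseudo-Frobenius
  -- condition (8) is a statement about T_y.
  InPFℕ[z⊕eᵢ]⇔ : InPFℕ g (z ⊕ e i) m ⇔ (∀ k → 1 ≤ k → k ≢ m → InTℕ g y k → InTℕ g y (m ℕ.+ k))
  InPFℕ[z⊕eᵢ]⇔ = mk⇔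
    (λ (_ , m+T⊆T) k 1≤k k≢m k∈T r →
       trans (sym (z⊕eᵢ≡y r (m+k≢m 1≤k))) (m+T⊆T k 1≤k (λ r′ → trans (z⊕eᵢ≡y r′ k≢m) (k∈T r′)) r))
    (λ m+T⊆T → m∉T[z⊕eᵢ] , λ k 1≤k k∈T →
       let k≢m : k ≢ m
           k≢m = λ { refl → m∉T[z⊕eᵢ] k∈T }
       in λ r → trans (z⊕eᵢ≡y r (m+k≢m 1≤k))
                  (m+T⊆T k 1≤k k≢m (λ r′ → trans (sym (z⊕eᵢ≡y r′ k≢m)) (k∈T r′)) r))
    where
    m+k≢m : ∀ {k} → 1 ≤ k → m ℕ.+ k ≢ m
    m+k≢m 1≤k eq = ℕP.<⇒≢ (ℕP.m<m+n m 1≤k) (sym eq)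

module Child⇒Criterion {F g : ℕ} (F<2g : F < 2 * g) {y z : KVec}
  (Y : IsBitKunz F g y) (Z : IsBitKunz F g z) {m : ℕ} (m-min : IsMinZero g y m)
  (2m<F : 2 * m < F) (z≈ : z ≈[ g ] (y ⊕ e m ⊖ e (F ∸ m))) where

  i : ℕ
  i = F ∸ m

  1≤m : 1 ≤ m
  1≤m = proj₁ (proj₁ m-min)

  m<F : m < F
  m<F = ℕP.≤-<-trans (ℕP.m≤m+n m (m ℕ.+ 0)) 2m<F

  m+i≡F : m ℕ.+ i ≡ F
  m+i≡F = ℕP.m+[n∸m]≡n (ℕP.<⇒≤ m<F)

  m<i : m < i
  m<i = m+i≡F∧2m<F⇒m<i m+i≡F 2m<F

  zm≡1 : z m ≡ + 1
  zm≡1 = trans (z≈ m (proj₁ m-min))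
           (trans (⊕e⊖e-at-added y (ℕP.<⇒≢ m<i)) (cong (_+ + 1) (proj₁ (proj₂ m-min))))

  y≈ : y ≈[ g ] (z ⊕ e i ⊖ e m)
  y≈ = ⊕e⊖e-inverse {g} z≈

  ir : InRange g i
  ir = <⇒InRange {g} (ℕP.≤-trans 1≤m (ℕP.<⇒≤ m<i)) (ℕP.≤-<-trans (ℕP.m∸n≤m F m) F<2g)

  -- y_i = z_i + 1 is a bit, so z_i = 0.
  zi≡0 : z i ≡ + 0
  zi≡0 with IsBitKunz.bits Z ir
  ... | inj₁ zi≡0 = zi≡0
  ... | inj₂ zi≡1 = ⊥-elim (2-not-bit (subst IsBit yi≡2 (IsBitKunz.bits Y ir)))
    where
    yi≡2 : y i ≡ + 2
    yi≡2 = trans (y≈ i ir) (trans (⊕e⊖e-at-added z (ℕP.<⇒≢ m<i ∘ sym)) (cong (_+ + 1) zi≡1))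

  open Exchange {F} {g} {m} {i} F<2g m+i≡F 1≤m m<i {y} {z} y≈ zm≡1 zi≡0 hiding (ir)

  y-zero-closed : ∀ {a b} → y a ≡ + 0 → y b ≡ + 0 → InRange g (a ℕ.+ b) → y (a ℕ.+ b) ≡ + 0
  y-zero-closed {a} {b} ya≡0 yb≡0 =
    NumericalSemigroup.closed-+ (IsBitKunz.semigroup Y) a b (λ _ → ya≡0) (λ _ → yb≡0)

  y2m≡0 : y (2 * m) ≡ + 0
  y2m≡0 = subst (λ t → y t ≡ + 0) (sym (2*m≡m+m m))
            (y-zero-closed ym≡0 ym≡0 (subst (InRange g) (2*m≡m+m m) 2mr))

  z-sum-below-i : ∀ j → 1 ≤ j → j < i → z j + z (i ∸ j) ≥ + 1
  z-sum-below-i j 1≤j j<i = bit-sum≥1 (IsBitKunz.bits Z jr) (IsBitKunz.bits Z i∸jr) not-both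
    where
    jr = InRange-≤ {g} 1≤j (ℕP.<⇒≤ j<i) ir
    i∸j<i = ℕP.∸-monoʳ-< {i} {j} {0} 1≤j (ℕP.<⇒≤ j<i)
    i∸jr = InRange-≤ {g} (ℕP.m<n⇒0<n∸m j<i) (ℕP.<⇒≤ i∸j<i) ir
    not-both : z j ≡ + 0 → z (i ∸ j) ≡ + 0 → ⊥
    not-both zj≡0 zi∸j≡0 = 0≢1 (trans (sym yi≡0) yi≡1)
      where
      yj≡0 = trans (y≡z jr (z-zero⇒≢m zj≡0) (ℕP.<⇒≢ j<i)) zj≡0
      yi∸j≡0 = trans (y≡z i∸jr (z-zero⇒≢m zi∸j≡0) (ℕP.<⇒≢ i∸j<i)) zi∸j≡0
      yi≡0 = subst (λ t → y t ≡ + 0) (ℕP.m+[n∸m]≡n (ℕP.<⇒≤ j<i))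
               (y-zero-closed yj≡0 yi∸j≡0 (subst (InRange g) (sym (ℕP.m+[n∸m]≡n (ℕP.<⇒≤ j<i))) ir))

  min-zero-of-z : ∃[ m′ ] (IsMinZero g z m′ × F ∸ i < m′)
  min-zero-of-z with IsMinZero-exists {g} ir zi≡0
  ... | m′ , m′-min = m′ , m′-min , subst (_< m′) (sym F∸i≡m) (m<m′ m′-min)
    where
    m<m′ : ∀ {m′} → IsMinZero g z m′ → m < m′
    m<m′ {m′} ((1≤m′ , _) , zm′≡0 , _) with ℕP.<-cmp m m′
    ... | tri< m<m′ _ _ = m<m′
    ... | tri≈ _ refl _ = ⊥-elim (z-zero⇒≢m zm′≡0 refl)
    ... | tri> _ _ m′<m = ⊥-elim (proj₂ (proj₂ m-min) m′ 1≤m′ m′<m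
            (trans (y≡z m′r (ℕP.<⇒≢ m′<m) (ℕP.<⇒≢ (ℕP.<-trans m′<m m<i))) zm′≡0))
      where m′r = InRange-≤ {g} 1≤m′ (ℕP.<⇒≤ m′<m) mr

  2F≢3i : 2 * F ≢ 3 * i
  2F≢3i 2F≡3i = y-zero⇒≢i y2m≡0 (to (m+i≡F⇒[2F≡3i⇔2m≡i] m+i≡F) 2F≡3i)

  z2[F∸i]≡0 : z (2 * (F ∸ i)) ≡ + 0
  z2[F∸i]≡0 rewrite F∸i≡m = trans (sym (y≡z 2mr (ℕP.<⇒≢ m<2m ∘ sym) (y-zero⇒≢i y2m≡0))) y2m≡0

  z-one-up-to-m : ∀ {k} → 1 ≤ k → k ≤ m → z k ≡ + 1
  z-one-up-to-m {k} 1≤k k≤m with ℕP.m≤n⇒m<n∨m≡n k≤m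
  ... | inj₂ refl = zm≡1
  ... | inj₁ k<m with IsBitKunz.bits Z kr
    where kr = InRange-≤ {g} 1≤k k≤m mr
  ...   | inj₂ zk≡1 = zk≡1
  ...   | inj₁ zk≡0 = ⊥-elim (proj₂ (proj₂ m-min) k 1≤k k<m
            (trans (y≡z kr (ℕP.<⇒≢ k<m) (ℕP.<⇒≢ (ℕP.<-trans k<m m<i))) zk≡0))
    where kr = InRange-≤ {g} 1≤k k≤m mr

  z-sum-below-2m : ∀ j → 1 ≤ j → j < 2 * m → z j + z (2 * m ∸ j) ≥ + 1
  z-sum-below-2m j 1≤j j<2m with j ℕP.≤? m
  ... | yes j≤m = bit-sum≥1 (IsBitKunz.bits Z jr) (IsBitKunz.bits Z 2m∸jr)
                    (λ zj≡0 _ → 0≢1 (trans (sym zj≡0) (z-one-up-to-m 1≤j j≤m)))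
    where
    jr = InRange-≤ {g} 1≤j (ℕP.<⇒≤ j<2m) 2mr
    2m∸jr = InRange-≤ {g} (ℕP.m<n⇒0<n∸m j<2m) (ℕP.m∸n≤m (2 * m) j) 2mr
  ... | no j≰m = bit-sum≥1 (IsBitKunz.bits Z jr) (IsBitKunz.bits Z 2m∸jr)
                   (λ _ z2m∸j≡0 → 0≢1 (trans (sym z2m∸j≡0) (z-one-up-to-m (ℕP.m<n⇒0<n∸m j<2m) 2m∸j≤m)))
    where
    jr = InRange-≤ {g} 1≤j (ℕP.<⇒≤ j<2m) 2mr
    2m∸jr = InRange-≤ {g} (ℕP.m<n⇒0<n∸m j<2m) (ℕP.m∸n≤m (2 * m) j) 2mr
    2m∸j≤m : 2 * m ∸ j ≤ m
    2m∸j≤m = ℕP.m≤n+o⇒m∸n≤o (2 * m) j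
      (subst (_≤ j ℕ.+ m) (sym (2*m≡m+m m)) (ℕP.+-monoˡ-≤ m (ℕP.<⇒≤ (ℕP.≰⇒> j≰m))))

  z-sum-below-2[F∸i] : ∀ j → 1 ≤ j → j < 2 * (F ∸ i) → z j + z (2 * (F ∸ i) ∸ j) ≥ + 1
  z-sum-below-2[F∸i] rewrite F∸i≡m = z-sum-below-2m

  m∈PF[z⊕eᵢ] : InPFK g (z ⊕ e i) (+ (F ∸ i))
  m∈PF[z⊕eᵢ] rewrite F∸i≡m = from (InPFK⇔InPFℕ {g} {z ⊕ e i}) (from InPFℕ[z⊕eᵢ]⇔
    (λ k _ _ k∈T → NumericalSemigroup.closed-+ (IsBitKunz.semigroup Y) m k (λ _ → ym≡0) k∈T))

  y≈′ : y ≈[ g ] (z ⊕ e i ⊖ e (F ∸ i))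
  y≈′ rewrite F∸i≡m = y≈

  criterion : ChildCriterion F g z y i
  criterion = ir , y≈′ , zi≡0 , z-sum-below-i , (F<2i , i<F) , min-zero-of-z , 2F≢3i
            , z2[F∸i]≡0 , z-sum-below-2[F∸i] , m∈PF[z⊕eᵢ]

module Criterion⇒Child {F g : ℕ} (F<2g : F < 2 * g) {x z y : KVec} (z∈[x] : InClass F g x z)
  {i : ℕ} (ir : InRange g i) (y≈ : y ≈[ g ] (z ⊕ e i ⊖ e (F ∸ i))) (zi≡0 : z i ≡ + 0)
  (z-sum-below-i : ∀ j → 1 ≤ j → j < i → z j + z (i ∸ j) ≥ + 1)
  (F<2i×i<F : F < 2 * i × i < F)
  (min-zero-of-z : ∃[ m′ ] (IsMinZero g z m′ × F ∸ i < m′))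
  (2F≢3i : 2 * F ≢ 3 * i) (z2[F∸i]≡0 : z (2 * (F ∸ i)) ≡ + 0)
  (m∈PF[z⊕eᵢ] : InPFK g (z ⊕ e i) (+ (F ∸ i))) where

  m : ℕ
  m = F ∸ i

  Z : IsBitKunz F g z
  Z = InK⇒IsBitKunz {g = g} F<2g (proj₁ z∈[x])

  i<F : i < F
  i<F = proj₂ F<2i×i<F

  m+i≡F : m ℕ.+ i ≡ F
  m+i≡F = ℕP.m∸n+n≡m (ℕP.<⇒≤ i<F)

  1≤m : 1 ≤ m
  1≤m = ℕP.m<n⇒0<n∸m i<F

  m<i : m < i
  m<i = m+i≡F∧F<2i⇒m<i m+i≡F (proj₁ F<2i×i<F)

  m′ : ℕ
  m′ = proj₁ min-zero-of-z

  m<m′ : m < m′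
  m<m′ = proj₂ (proj₂ min-zero-of-z)

  z-nonzero-below-m′ : ∀ {k} → 1 ≤ k → k < m′ → z k ≢ + 0
  z-nonzero-below-m′ = proj₂ (proj₂ (proj₁ (proj₂ min-zero-of-z))) _

  zm≡1 : z m ≡ + 1
  zm≡1 with IsBitKunz.bits Z (InRange-≤ {g} 1≤m (ℕP.<⇒≤ m<i) ir)
  ... | inj₁ zm≡0 = ⊥-elim (z-nonzero-below-m′ 1≤m m<m′ zm≡0)
  ... | inj₂ zm≡1 = zm≡1

  open Exchange {F} {g} {m} {i} F<2g m+i≡F 1≤m m<i {y} {z} y≈ zm≡1 zi≡0 hiding (ir; i<F)

  y-bits : Bits g y
  y-bits {k} r with k ℕP.≟ m | k ℕP.≟ i
  ... | yes refl | _ = inj₁ ym≡0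
  ... | no _ | yes refl = inj₂ yi≡1
  ... | no k≢m | no k≢i = subst IsBit (sym (y≡z r k≢m k≢i)) (IsBitKunz.bits Z r)

  y-zero⇒z-zero : ∀ {k} → InRange g k → k ≢ m → y k ≡ + 0 → z k ≡ + 0
  y-zero⇒z-zero r k≢m yk≡0 = trans (sym (y≡z r k≢m (y-zero⇒≢i yk≡0))) yk≡0

  y-zero-m+ : ∀ {b} → InRange g b → InRange g (m ℕ.+ b) → b ≢ m → y b ≡ + 0 → y (m ℕ.+ b) ≡ + 0
  y-zero-m+ {b} rb rm+b b≢m yb≡0 =
    to InPFℕ[z⊕eᵢ]⇔ (to (InPFK⇔InPFℕ {g} {z ⊕ e i}) m∈PF[z⊕eᵢ]) b (proj₁ rb) b≢m (λ _ → yb≡0) rm+b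

  y-zero-m+m : InRange g (m ℕ.+ m) → y (m ℕ.+ m) ≡ + 0
  y-zero-m+m rm+m = trans (y≡z rm+m m+m≢m m+m≢i) (subst (λ t → z t ≡ + 0) (2*m≡m+m m) z2[F∸i]≡0)
    where
    m+m≢m : m ℕ.+ m ≢ m
    m+m≢m eq = ℕP.<⇒≢ m<2m (sym (trans (2*m≡m+m m) eq))
    m+m≢i : m ℕ.+ m ≢ i
    m+m≢i eq = 2F≢3i (from (m+i≡F⇒[2F≡3i⇔2m≡i] m+i≡F) (trans (2*m≡m+m m) eq))

  -- Both summands lie in T_z, so by (2) their sum is not i, and it is not m
  -- because the least zero of z exceeds m.
  y-zero-sum-off-m : ∀ {a b} → InRange g a → InRange g b → InRange g (a ℕ.+ b) → a ≢ m → b ≢ m →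
    y a ≡ + 0 → y b ≡ + 0 → y (a ℕ.+ b) ≡ + 0
  y-zero-sum-off-m {a} {b} ra rb ra+b a≢m b≢m ya≡0 yb≡0 =
    trans (y≡z ra+b a+b≢m a+b≢i) za+b≡0
    where
    za≡0 = y-zero⇒z-zero ra a≢m ya≡0
    zb≡0 = y-zero⇒z-zero rb b≢m yb≡0
    za+b≡0 = NumericalSemigroup.closed-+ (IsBitKunz.semigroup Z) a b (λ _ → za≡0) (λ _ → zb≡0) ra+b
    m′≤a : m′ ≤ a
    m′≤a = ℕP.≮⇒≥ (λ a<m′ → z-nonzero-below-m′ (proj₁ ra) a<m′ za≡0)
    a+b≢m : a ℕ.+ b ≢ m
    a+b≢m eq = ℕP.<-irrefl (sym eq) (ℕP.<-≤-trans m<m′ (ℕP.≤-trans m′≤a (ℕP.m≤m+n a b)))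
    a+b≢i : a ℕ.+ b ≢ i
    a+b≢i refl = 0-not-≥1 (subst (_≥ + 1) za+zb≡0 (z-sum-below-i a (proj₁ ra) (ℕP.m<m+n a (proj₁ rb))))
      where
      za+zb≡0 : z a + z (a ℕ.+ b ∸ a) ≡ + 0
      za+zb≡0 = cong₂ _+_ za≡0 (trans (cong z (ℕP.m+n∸m≡n a b)) zb≡0)

  y-zero-closed : ZeroClosed g y
  y-zero-closed {a} {b} ra rb ra+b ya≡0 yb≡0 with a ℕP.≟ m | b ℕP.≟ m
  ... | yes refl | yes refl = y-zero-m+m ra+b
  ... | yes refl | no b≢m = y-zero-m+ rb ra+b b≢m yb≡0
  ... | no a≢m | yes refl = subst (λ t → y t ≡ + 0) (ℕP.+-comm m a)
                              (y-zero-m+ ra (subst (InRange g) (ℕP.+-comm a m) ra+b) a≢m ya≡0)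
  ... | no a≢m | no b≢m = y-zero-sum-off-m ra rb ra+b a≢m b≢m ya≡0 yb≡0

  Tz⇒Ty : ∀ {n} → n ≢ m → n ≢ i → InTℕ g z n → InTℕ g y n
  Tz⇒Ty n≢m n≢i t r = trans (y≡z r n≢m n≢i) (t r)

  Ty⇒Tz : ∀ {n} → n ≢ m → n ≢ i → InTℕ g y n → InTℕ g z n
  Ty⇒Tz n≢m n≢i t r = trans (sym (y≡z r n≢m n≢i)) (t r)

  below-F-m : ∀ {n} → F ≤ n → n ≢ m
  below-F-m F≤n refl = ℕP.<-irrefl refl (ℕP.<-≤-trans (ℕP.<-trans m<i i<F) F≤n)

  below-F-i : ∀ {n} → F ≤ n → n ≢ i
  below-F-i F≤n refl = ℕP.<-irrefl refl (ℕP.<-≤-trans i<F F≤n)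

  y-frobenius : Frobenius (InTℕ g y) F
  y-frobenius =
    proj₁ z-frobenius ∘ Ty⇒Tz (below-F-m ℕP.≤-refl) (below-F-i ℕP.≤-refl) ,
    λ n F<n → Tz⇒Ty (below-F-m (ℕP.<⇒≤ F<n)) (below-F-i (ℕP.<⇒≤ F<n)) (proj₂ z-frobenius n F<n)
    where z-frobenius = IsBitKunz.frobenius Z

  y-genus : Genus (InTℕ g y) g
  y-genus = genus-exchange m i (IsBitKunz.genus Z)
    (λ t → 0≢1 (trans (sym (t mr)) zm≡1)) (λ _ → zi≡0)
    (λ _ → ym≡0) (λ t → 0≢1 (trans (sym (t ir)) yi≡1))
    Tz⇒Ty Ty⇒Tz

  y∈K : InK F g y
  y∈K = IsBitKunz⇒InK record
    { bits      = y-bits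
    ; semigroup = InTℕ-numericalSemigroup {g} {y} y-zero-closed
    ; frobenius = y-frobenius
    ; genus     = y-genus
    }

  θy≈θz : θK F g y ≈[ g ] θK F g z
  θy≈θz = θK-flip {F} {g} {m} {y} {z} mr 2m<F ym≡0 (λ zm≡0 → z-zero⇒≢m zm≡0 refl) agree
            (subst (λ t → y ≈[ g ] (z ⊕ e t ⊖ e m)) (sym F∸m≡i) y≈)
    where
    agree : ∀ {j} → InRange g j → j ≢ m → 2 * j < F → y j ≡ z j
    agree r j≢m 2j<F = y≡z r j≢m λ { refl → ℕP.<-asym 2j<F F<2i }

  y-nonzero-below-m : ∀ k → 1 ≤ k → k < m → y k ≢ + 0
  y-nonzero-below-m k 1≤k k<m yk≡0 =
    z-nonzero-below-m′ 1≤k (ℕP.<-trans k<m m<m′) (y-zero⇒z-zero kr (ℕP.<⇒≢ k<m) yk≡0)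
    where kr = InRange-≤ {g} 1≤k (ℕP.<⇒≤ k<m) mr

  edge : EdgeK F g y z
  edge = m , (mr , ym≡0 , y-nonzero-below-m) , 2m<F ,
         subst (λ t → z ≈[ g ] (y ⊕ e m ⊖ e t)) (sym F∸m≡i) z≈

  child : ChildK F g x y z
  child = (y∈K , λ k r → trans (θy≈θz k r) (proj₂ z∈[x] k r)) , z∈[x] , edge

proposition19 :
    ∀ (F g : ℕ) (x z y : KVec) →
    1 ≤ F → 1 ≤ g → g ≤ F → F ≤ 2 * g ∸ 1 →
    InEK F g x → InClass F g x z →
    ChildK F g x y z ⇔
      (∃[ i ] (InRange g i × (y ≈[ g ] (z ⊕ e i ⊖ e (F ∸ i)))
        × (z i ≡ + 0)
        × (∀ j → 1 ≤ j → j < i → z j + z (i ∸ j) ≥ + 1)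
        × (F < 2 * i × i < F)
        × (∃[ m ] (IsMinZero g z m × F ∸ i < m))
        × (2 * F ≢ 3 * i)
        × (z (2 * (F ∸ i)) ≡ + 0)
        × (∀ j → 1 ≤ j → j < 2 * (F ∸ i) → z j + z (2 * (F ∸ i) ∸ j) ≥ + 1)
        × InPFK g (z ⊕ e i) (+ (F ∸ i))))
proposition19 F g x z y 1≤F _ _ F≤2g∸1 _ z∈[x] = mk⇔ child⇒criterion criterion⇒child
  where
  F<2g : F < 2 * g
  F<2g = InRange⇒< {g} (1≤F , F≤2g∸1)

  child⇒criterion : ChildK F g x y z → ∃[ i ] ChildCriterion F g z y i
  child⇒criterion ((y∈K , _) , (z∈K , _) , m , m-min , 2m<F , z≈) =
    F ∸ m , Child⇒Criterion.criterion {F} {g} F<2g {y} {z}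
              (InK⇒IsBitKunz {g = g} F<2g y∈K) (InK⇒IsBitKunz {g = g} F<2g z∈K) m-min 2m<F z≈

  criterion⇒child : ∃[ i ] ChildCriterion F g z y i → ChildK F g x y z
  criterion⇒child (i , ir , y≈ , zi≡0 , c₂ , c₃ , c₄ , c₅ , c₆ , _ , c₈) =
    Criterion⇒Child.child {F} {g} F<2g z∈[x] {i} ir y≈ zi≡0 c₂ c₃ c₄ c₅ c₆ c₈
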